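{- For every $\varepsilon>0$ there exists a prime $p_\varepsilon$ such that for all primes $p\ge p_\varepsilon$, all integers $N\ge 1$ and every $\alpha\in\mathscr B(p,N)$, \[ \frac{1}{\#\mathcal V(p,N)^2}\,\#\Big\{(\beta_1,\beta_2)\in\mathcal V(p,N)^2:\ \big|\mathfrak d_{p,N}(\alpha,\beta_1)-\mathfrak d_{p,N}(\alpha,\beta_2)\big|\le\varepsilon\Big\}\ \ge\ 1-\varepsilon . \]
   Context: Let $p$ be an odd prime, $\omega=\exp(2\pi i/p)$, and $\mathbb{Q}(\omega)$ the $p$-th cyclotomic field, with $\mathbb{Q}$-basis $\omega,\omega^2,\dots,\omega^{p-1}$. For $\gamma\in\mathbb{Q}(\omega)$, $\mathrm{Tr}(\gamma)=\sum_{\sigma\in\mathrm{Gal}(\mathbb{Q}(\omega)/\mathbb{Q})}\sigma(\gamma)$. Let $\psi(\gamma)=(\mathrm{Tr}(\gamma\omega),\dots,\mathrm{Tr}(\gamma\omega^{p-1}))\in\mathbb{Q}^{p-1}$, let $\|\gamma\|$ be the Euclidean norm of $\psi(\gamma)$, and let $d(\alpha,\beta)=\|\beta-\alpha\|$. The normalized distance is $\mathfrak d_{p,N}(\alpha,\beta)=d(\alpha,\beta)/(2Np(p-1)^{1/2})$ (this denominator is the diameter of $\mathscr B(p,N)$ for $d$). For an integer $N\ge1$, $\mathscr B(p,N)=\{a_1\omega+\dots+a_{p-1}\omega^{p-1}: a_j\in[-N,N]\cap\mathbb{Z}\}$ and $\mathcal V(p,N)=\{a_1\omega+\dots+a_{p-1}\omega^{p-1}: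 a_j\in\{ -N,N\}\}$ (so $\#\mathcal V(p,N)=2^{p-1}$).
   Formalization: The parameter ε ranges over the positive rationals. -}

module Defs where

open import Data.Bool using (Bool; true; false; if_then_else_; _∨_)
open import Data.Nat as ℕ using (ℕ; zero; suc; _∸_)
open import Data.Nat.Divisibility using (_∣?_)
open import Data.Integer as ℤ using (ℤ; +_; -_)
open import Data.Rational as ℚ using (ℚ; _≤ᵇ_; 0ℚ)
open import Data.Fin using (Fin; toℕ) renaming (zero to fz; suc to fs)
open import Data.List using (List; []; _∷_; _++_; map; concatMap; filter; length)
open import Data.Vec using (Vec; []; _∷_; lookup)
open import Relation.Nullary using (does)
open import Relation.Nullary.Decidable using (yes; no)
open import Data.Bool using (T)
open import Data.Product using (_×_; _,_)

-- Elements of Q(ω) with integer coordinates in the basis ω, ω², …, ω^(p-1):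
-- a vector  c : Vec ℤ (p ∸ 1)  represents  Σ_j c_j ω^(j+1)  (j = 0 … p-2).

Σℤ : (n : ℕ) → (Fin n → ℤ) → ℤ
Σℤ zero    f = + 0
Σℤ (suc n) f = f fz ℤ.+ Σℤ n (λ i → f (fs i))

-- Tr(ω^k) for the p-th cyclotomic field: Σ_{t=1}^{p-1} ω^{tk},
-- which equals p-1 if p ∣ k and -1 otherwise.
trPow : (p k : ℕ) → ℤ
trPow p k = if does (p ∣? k) then + (p ∸ 1) else - (+ 1)

-- Tr(γ ω^i) for γ = Σ_j c_j ω^(j+1), by linearity of the trace:
-- Σ_j c_j Tr(ω^(j+1+i)).
trTimesPow : (p : ℕ) → Vec ℤ (p ∸ 1) → ℕ → ℤ
trTimesPow p c i = Σℤ (p ∸ 1) (λ j → lookup c j ℤ.* trPow p (suc (toℕ j) ℕ.+ i))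

ψ : (p : ℕ) → Vec ℤ (p ∸ 1) → Fin (p ∸ 1) → ℤ
ψ p c i = trTimesPow p c (suc (toℕ i))

normSq : (p : ℕ) → Vec ℤ (p ∸ 1) → ℤ
normSq p c = Σℤ (p ∸ 1) (λ i → ψ p c i ℤ.* ψ p c i)

vsub : {n : ℕ} → Vec ℤ n → Vec ℤ n → Vec ℤ n
vsub []       []       = []
vsub (x ∷ xs) (y ∷ ys) = (x ℤ.- y) ∷ vsub xs ys

distSq : (p : ℕ) → Vec ℤ (p ∸ 1) → Vec ℤ (p ∸ 1) → ℤ
distSq p α β = normSq p (vsub β α)

InBox : {n : ℕ} → ℕ → Vec ℤ n → Set
InBox N []       = Data.Unit.⊤ where import Data.Unit
InBox N (x ∷ xs) = ((- (+ N)) ℤ.≤ x × x ℤ.≤ (+ N)) × InBox N xs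

allSigns : (n : ℕ) → List (Vec Bool n)
allSigns zero    = [] ∷ []
allSigns (suc n) = map (true ∷_) (allSigns n) ++ map (false ∷_) (allSigns n)

vertex : {n : ℕ} → ℕ → Vec Bool n → Vec ℤ n
vertex N []       = []
vertex N (b ∷ bs) = (if b then + N else - (+ N)) ∷ vertex N bs

-- The list 𝓥(p,N) (each element listed exactly once; length 2^(p-1)).
𝓥 : (p N : ℕ) → List (Vec ℤ (p ∸ 1))
𝓥 p N = map (vertex N) (allSigns (p ∸ 1))

pairs : {A : Set} → List A → List (A × A)
pairs xs = concatMap (λ x → map (x ,_) xs) xs

ℤ→ℚ : ℤ → ℚ
ℤ→ℚ z = z ℚ./ 1

-- For rationals a, b, c ≥ 0:   |√a − √b| ≤ √c
--   ⇔ a + b − c ≤ 2√(ab)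
--   ⇔ (a + b − c ≤ 0) ∨ ((a + b − c)² ≤ 4ab).
-- (Real square roots are not available; this Boolean is that test.)
absSqrtDiffLeSqrt : ℚ → ℚ → ℚ → Bool
absSqrtDiffLeSqrt a b c =
  ((a ℚ.+ b ℚ.- c) ≤ᵇ 0ℚ) ∨
  (((a ℚ.+ b ℚ.- c) ℚ.* (a ℚ.+ b ℚ.- c)) ≤ᵇ ((ℤ→ℚ (+ 4)) ℚ.* a ℚ.* b))

-- |𝔡(α,β₁) − 𝔡(α,β₂)| ≤ ε, where 𝔡 = d / (2 N p (p-1)^{1/2}):
-- equivalently |d(α,β₁) − d(α,β₂)| ≤ √(ε² · 4 N² p² (p-1)).
closeNormDist : (p N : ℕ) → ℚ → Vec ℤ (p ∸ 1) → Vec ℤ (p ∸ 1) → Vec ℤ (p ∸ 1) → Bool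
closeNormDist p N ε α β₁ β₂ =
  absSqrtDiffLeSqrt (ℤ→ℚ (distSq p α β₁)) (ℤ→ℚ (distSq p α β₂))
    (ε ℚ.* ε ℚ.* ℤ→ℚ (+ (4 ℕ.* N ℕ.* N ℕ.* p ℕ.* p ℕ.* (p ∸ 1))))

closeCount : (p N : ℕ) → ℚ → Vec ℤ (p ∸ 1) → ℕ
closeCount p N ε α =
  length (filter (λ q → T? (closeNormDist p N ε α (Data.Product.proj₁ q) (Data.Product.proj₂ q)))
                 (pairs (𝓥 p N)))
  where
    import Data.Product
    open import Relation.Nullary.Decidable using (Dec)
    T? : (b : Bool) → Dec (T b)
    T? = Data.Bool.T?
    import Data.Bool

{-# OPTIONS --safe #-}
-- Write n = p − 1 and let c ∈ ℤⁿ be the coordinates of γ. As Tr(ωᵏ) is p − 1 or −1 according as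
-- p ∣ k or not, the trace coordinates of γ are p·c_{n+1−i} − Σc, so ‖γ‖² = p²⟨c,c⟩ − (p+1)(Σc)².
-- For a vertex β (all |β_j| = N) this makes d(α,β)² a constant minus the deviation
-- 2p²⟨β,α⟩ + (p+1)Σβ(Σβ − 2Σα). Summed over the 2ⁿ vertices, ⟨β,y⟩² totals 2ⁿN²⟨y,y⟩, so by
-- Chebyshev only O(2ⁿ/n) vertices have |⟨β,α⟩| or |Σβ| large compared with nN² resp. nN. For two
-- of the remaining vertices the squared distances differ by at most ε²·4N²p²(p−1), hence their
-- normalised distances by at most ε; once p is large these pairs are a (1 − ε)-fraction of all.
module Submission where

open import Defs

module Euclid where

  open import Data.Nat.Base using (zero; suc; s≤s; z≤n; _+_; _≤_; _<_; _!; >-nonZero)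
  open import Data.Nat.Properties using (_<?_; ≮⇒≥; 1≤n!; +-monoˡ-<; <⇒≢; <-trans)
  open import Data.Nat.Divisibility using (_∣_; ∣m+n∣m⇒∣n; ∣1⇒≡1; ∣-trans; m∣m*n; m≤n⇒m!∣n!)
  open import Data.Nat.Primality using (Prime; ¬prime[0]; ¬prime[1])
  open import Data.Nat.Primality.Factorisation using (factorise)
  open import Data.List.Base using ([]; _∷_)
  open import Data.List.Relation.Unary.All using (_∷_)
  open import Data.Product using (∃; _×_; _,_)
  open import Relation.Binary.PropositionalEquality using (sym; subst)
  open import Relation.Nullary using (contradiction; yes; no)

  prime-factor : ∀ m → 1 < m → ∃ λ q → Prime q × q ∣ m
  prime-factor m 1<m with factorise m {{>-nonZero (<-trans (s≤s z≤n) 1<m)}}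
  ... | record { factors = [] ; isFactorisation = m≡1 } = contradiction (sym m≡1) (<⇒≢ 1<m)
  ... | record { factors = q ∷ _ ; isFactorisation = m≡q*qs ; factorsPrime = q-prime ∷ _ } =
    q , q-prime , subst (q ∣_) (sym m≡q*qs) (m∣m*n _)

  prime∣! : ∀ {q B} → Prime q → q ≤ B → q ∣ B !
  prime∣! {zero}  q-prime _   = contradiction q-prime ¬prime[0]
  prime∣! {suc q} _       q≤B = ∣-trans (m∣m*n (q !)) (m≤n⇒m!∣n! q≤B)

  prime-above : ∀ B → ∃ λ q → Prime q × B < q
  prime-above B with prime-factor (B ! + 1) (+-monoˡ-< 1 (1≤n! B))
  ... | q , q-prime , q∣B!+1 with B <? q
  ...   | yes B<q = q , q-prime , B<q
  ...   | no  B≮q = contradiction (subst Prime q≡1 q-prime) ¬prime[1]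
    where q≡1 = ∣1⇒≡1 (∣m+n∣m⇒∣n q∣B!+1 (prime∣! q-prime (≮⇒≥ B≮q)))

module Norm where

  open import Data.Bool.Base using (true; false; if_then_else_)
  open import Data.Nat.Base as ℕ using (ℕ; zero; suc; _<_; z<s)
  import Data.Nat.Properties as ℕ
  open import Data.Nat.Divisibility using (_∣_; _∣?_; divides; ∣-refl)
  open import Data.Integer.Base using (ℤ; +_; -_; _+_; _-_; _*_; ∣_∣; 0ℤ; 1ℤ; -1ℤ)
  import Data.Integer.Properties as ℤ
  open import Data.Integer.Tactic.RingSolver using (solve-∀)
  open import Algebra.Properties.Semiring.Sum ℤ.+-*-semiring
    using (sum; sum-cong-≗; ∑-distrib-+; *-distribˡ-sum; sum-replicate-zero; sum-permute)
  open import Data.Fin.Base using (Fin; toℕ; opposite) renaming (zero to fz; suc to fs)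
  open import Data.Fin.Properties using (_≟_; toℕ<n; toℕ-injective; opposite-prop)
  import Data.Fin.Permutation as Permutation
  open import Data.Vec.Base using (Vec; _∷_; lookup)
  open import Function.Base using (_∘_)
  open import Function.Bundles using (_⇔_; mk⇔; Equivalence)
  open import Relation.Binary.PropositionalEquality
  open import Relation.Nullary using (does; contradiction)
  open import Relation.Nullary.Decidable using (does-⇔)

  private variable n : ℕ

  Σℤ≡sum : ∀ n (f : Fin n → ℤ) → Σℤ n f ≡ sum f
  Σℤ≡sum zero    f = refl
  Σℤ≡sum (suc n) f = cong (_+_ (f fz)) (Σℤ≡sum n (f ∘ fs))

  sum-const : ∀ n x → sum {n} (λ _ → x) ≡ + n * x
  sum-const zero    x = refl
  sum-const (suc n) x = trans (cong (_+_ x) (sum-const n x)) (sym (ℤ.suc-* (+ n) x))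

  sum-* : ∀ x (f : Fin n → ℤ) → sum (λ j → x * f j) ≡ x * sum f
  sum-* x f = sym (*-distribˡ-sum x f)

  sum-δ : (f : Fin n → ℤ) (r : Fin n) → sum (λ j → if does (j ≟ r) then f j else 0ℤ) ≡ f r
  sum-δ {suc n} f fz     = trans (cong (_+_ (f fz)) (sum-replicate-zero n)) (ℤ.+-identityʳ (f fz))
  sum-δ {suc n} f (fs r) = trans (ℤ.+-identityˡ _) (sum-δ (f ∘ fs) r)

  m∣k∧0<k<m+m⇒k≡m : ∀ {m k} → m ∣ k → 0 < k → k < m ℕ.+ m → k ≡ m
  m∣k∧0<k<m+m⇒k≡m     (divides zero          refl) ()
  m∣k∧0<k<m+m⇒k≡m {m} (divides 1             refl) _ _ = ℕ.+-identityʳ m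
  m∣k∧0<k<m+m⇒k≡m {m} (divides (suc (suc q)) refl) _ k<2m =
    contradiction k<2m (ℕ.≤⇒≯ (ℕ.+-monoʳ-≤ m (ℕ.m≤m+n m (q ℕ.* m))))

  +suc≡n⇔≡opposite : (i j : Fin n) → (toℕ j ℕ.+ suc (toℕ i) ≡ n) ⇔ (j ≡ opposite i)
  +suc≡n⇔≡opposite {n} i j = mk⇔
    (λ eq → toℕ-injective (begin
      toℕ j                                 ≡⟨ ℕ.m+n∸n≡m (toℕ j) (suc (toℕ i)) ⟨
      toℕ j ℕ.+ suc (toℕ i) ℕ.∸ suc (toℕ i) ≡⟨ cong (ℕ._∸ suc (toℕ i)) eq ⟩
      n ℕ.∸ suc (toℕ i)                     ≡⟨ opposite-prop i ⟨
      toℕ (opposite i)                      ∎))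
    (λ { refl → trans (cong (ℕ._+ suc (toℕ i)) (opposite-prop i)) (ℕ.m∸n+n≡m (toℕ<n i)) })
    where open ≡-Reasoning

  trPow-opposite : (i j : Fin n) →
    trPow (suc n) (suc (toℕ j) ℕ.+ suc (toℕ i)) ≡ (if does (j ≟ opposite i) then + n else -1ℤ)
  trPow-opposite {n} i j = cong (if_then + n else -1ℤ) (does-⇔ p∣⇔opposite (suc n ∣? _) (j ≟ opposite i))
    where
    p∣⇔opposite : (suc n ∣ suc (toℕ j) ℕ.+ suc (toℕ i)) ⇔ (j ≡ opposite i)
    p∣⇔opposite = mk⇔
      (λ p∣ → Equivalence.to (+suc≡n⇔≡opposite i j)
                (ℕ.suc-injective (m∣k∧0<k<m+m⇒k≡m p∣ z<s (ℕ.+-mono-< (ℕ.s≤s (toℕ<n j)) (ℕ.s≤s (toℕ<n i))))))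
      (λ j≡ → subst (suc n ∣_) (cong suc (sym (Equivalence.from (+suc≡n⇔≡opposite i j) j≡))) ∣-refl)

  Σᵥ : Vec ℤ n → ℤ
  Σᵥ u = sum (lookup u)

  ⟪_,_⟫ : Vec ℤ n → Vec ℤ n → ℤ
  ⟪ u , v ⟫ = sum (λ j → lookup u j * lookup v j)

  ψ-formula : (c : Vec ℤ n) (i : Fin n) → ψ (suc n) c i ≡ + suc n * lookup c (opposite i) - Σᵥ c
  ψ-formula {n} c i = begin
    ψ (suc n) c i
      ≡⟨ Σℤ≡sum n _ ⟩
    sum (λ j → lookup c j * trPow (suc n) (suc (toℕ j) ℕ.+ suc (toℕ i)))
      ≡⟨ sum-cong-≗ (λ j → trans (cong (lookup c j *_) (trPow-opposite i j)) (weight (does (j ≟ opposite i)) (lookup c j))) ⟩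
    sum (λ j → (if does (j ≟ opposite i) then + suc n * lookup c j else 0ℤ) + -1ℤ * lookup c j)
      ≡⟨ ∑-distrib-+ {n} _ _ ⟩
    sum (λ j → if does (j ≟ opposite i) then + suc n * lookup c j else 0ℤ) + sum (λ j → -1ℤ * lookup c j)
      ≡⟨ cong₂ _+_ (sum-δ _ (opposite i)) (trans (sum-* -1ℤ (lookup c)) (ℤ.-1*i≡-i (Σᵥ c))) ⟩
    + suc n * lookup c (opposite i) - Σᵥ c ∎
    where
    open ≡-Reasoning
    weight : ∀ b x → x * (if b then + n else -1ℤ) ≡ (if b then + suc n * x else 0ℤ) + -1ℤ * x
    weight true  x = shift x (+ n)
      where
      shift : ∀ x m → x * m ≡ (1ℤ + m) * x + -1ℤ * x
      shift = solve-∀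
    weight false x = trans (ℤ.*-comm x -1ℤ) (sym (ℤ.+-identityˡ (-1ℤ * x)))

  normSq-formula : (c : Vec ℤ n) →
    normSq (suc n) c ≡ + suc n * + suc n * ⟪ c , c ⟫ - + suc (suc n) * (Σᵥ c * Σᵥ c)
  normSq-formula {n} c = begin
    normSq (suc n) c
      ≡⟨ Σℤ≡sum n _ ⟩
    sum (λ i → ψ (suc n) c i * ψ (suc n) c i)
      ≡⟨ sum-cong-≗ (λ i → cong₂ _*_ (ψ-formula c i) (ψ-formula c i)) ⟩
    sum (g ∘ opposite)
      ≡⟨ sum-permute g Permutation.reverse ⟨
    sum g
      ≡⟨ sum-cong-≗ (λ j → square-expand P (lookup c j) S) ⟩
    sum (λ j → P * P * (lookup c j * lookup c j) + (- (+ 2 * P * S) * lookup c j + S * S))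
      ≡⟨ ∑-distrib-+ {n} _ _ ⟩
    sum (λ j → P * P * (lookup c j * lookup c j)) + sum (λ j → - (+ 2 * P * S) * lookup c j + S * S)
      ≡⟨ cong₂ _+_ (sum-* (P * P) (λ j → lookup c j * lookup c j))
                   (trans (∑-distrib-+ {n} _ _) (cong₂ _+_ (sum-* (- (+ 2 * P * S)) (lookup c)) (sum-const n (S * S)))) ⟩
    P * P * ⟪ c , c ⟫ + (- (+ 2 * P * S) * S + + n * (S * S))
      ≡⟨ collect (+ n) ⟪ c , c ⟫ S ⟩
    P * P * ⟪ c , c ⟫ - (1ℤ + P) * (S * S) ∎
    where
    open ≡-Reasoning
    P S : ℤ
    P = + suc n
    S = Σᵥ c
    g : Fin n → ℤ
    g j = (P * lookup c j - S) * (P * lookup c j - S)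
    square-expand : ∀ P x S → (P * x - S) * (P * x - S) ≡ P * P * (x * x) + (- (+ 2 * P * S) * x + S * S)
    square-expand = solve-∀
    collect : ∀ m Q S → (1ℤ + m) * (1ℤ + m) * Q + (- (+ 2 * (1ℤ + m) * S) * S + m * (S * S))
                      ≡ (1ℤ + m) * (1ℤ + m) * Q - (1ℤ + (1ℤ + m)) * (S * S)
    collect = solve-∀

  lookup-vsub : (u v : Vec ℤ n) (j : Fin n) → lookup (vsub u v) j ≡ lookup u j - lookup v j
  lookup-vsub (x ∷ u) (y ∷ v) fz     = refl
  lookup-vsub (x ∷ u) (y ∷ v) (fs j) = lookup-vsub u v j

  Σᵥ-vsub : (u v : Vec ℤ n) → Σᵥ (vsub u v) ≡ Σᵥ u - Σᵥ v
  Σᵥ-vsub {n} u v = begin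
    Σᵥ (vsub u v)                               ≡⟨ sum-cong-≗ (λ j → trans (lookup-vsub u v j) (cong (_+_ (lookup u j)) (sym (ℤ.-1*i≡-i _)))) ⟩
    sum (λ j → lookup u j + -1ℤ * lookup v j)   ≡⟨ ∑-distrib-+ {n} _ _ ⟩
    Σᵥ u + sum (λ j → -1ℤ * lookup v j)         ≡⟨ cong (_+_ (Σᵥ u)) (trans (sum-* -1ℤ (lookup v)) (ℤ.-1*i≡-i _)) ⟩
    Σᵥ u - Σᵥ v                                 ∎
    where open ≡-Reasoning

  ⟪⟫-vsub : (u v : Vec ℤ n) → ⟪ vsub u v , vsub u v ⟫ ≡ ⟪ u , u ⟫ + - (+ 2) * ⟪ u , v ⟫ + ⟪ v , v ⟫
  ⟪⟫-vsub {n} u v = begin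
    ⟪ vsub u v , vsub u v ⟫
      ≡⟨ sum-cong-≗ (λ j → trans (cong₂ _*_ (lookup-vsub u v j) (lookup-vsub u v j)) (square-expand (lookup u j) (lookup v j))) ⟩
    sum (λ j → lookup u j * lookup u j + - (+ 2) * (lookup u j * lookup v j) + lookup v j * lookup v j)
      ≡⟨ trans (∑-distrib-+ {n} _ _) (cong (_+ ⟪ v , v ⟫) (∑-distrib-+ {n} _ _)) ⟩
    ⟪ u , u ⟫ + sum (λ j → - (+ 2) * (lookup u j * lookup v j)) + ⟪ v , v ⟫
      ≡⟨ cong (λ t → ⟪ u , u ⟫ + t + ⟪ v , v ⟫) (sum-* (- (+ 2)) (λ j → lookup u j * lookup v j)) ⟩
    ⟪ u , u ⟫ + - (+ 2) * ⟪ u , v ⟫ + ⟪ v , v ⟫ ∎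
    where
    open ≡-Reasoning
    square-expand : ∀ x y → (x - y) * (x - y) ≡ x * x + - (+ 2) * (x * y) + y * y
    square-expand = solve-∀

  deviation : Vec ℤ n → Vec ℤ n → ℤ
  deviation {n} α β = + 2 * (+ suc n * + suc n) * ⟪ β , α ⟫ + + suc (suc n) * (Σᵥ β * (Σᵥ β - + 2 * Σᵥ α))

  distSq-expand : (α β : Vec ℤ n) →
    distSq (suc n) α β ≡ + suc n * + suc n * (⟪ β , β ⟫ + ⟪ α , α ⟫) - + suc (suc n) * (Σᵥ α * Σᵥ α) - deviation α β
  distSq-expand {n} α β = begin
    normSq (suc n) (vsub β α)
      ≡⟨ normSq-formula (vsub β α) ⟩
    P * P * ⟪ vsub β α , vsub β α ⟫ - (1ℤ + P) * (Σᵥ (vsub β α) * Σᵥ (vsub β α))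
      ≡⟨ cong₂ (λ q s → P * P * q - (1ℤ + P) * (s * s)) (⟪⟫-vsub β α) (Σᵥ-vsub β α) ⟩
    P * P * (⟪ β , β ⟫ + - (+ 2) * ⟪ β , α ⟫ + ⟪ α , α ⟫) - (1ℤ + P) * ((Σᵥ β - Σᵥ α) * (Σᵥ β - Σᵥ α))
      ≡⟨ regroup P ⟪ β , β ⟫ ⟪ β , α ⟫ ⟪ α , α ⟫ (Σᵥ β) (Σᵥ α) ⟩
    P * P * (⟪ β , β ⟫ + ⟪ α , α ⟫) - (1ℤ + P) * (Σᵥ α * Σᵥ α) - deviation α β ∎
    where
    open ≡-Reasoning
    P : ℤ
    P = + suc n
    regroup : ∀ P B X A s a →
      P * P * (B + - (+ 2) * X + A) - (1ℤ + P) * ((s - a) * (s - a))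
        ≡ P * P * (B + A) - (1ℤ + P) * (a * a) - (+ 2 * (P * P) * X + (1ℤ + P) * (s * (s - + 2 * a)))
    regroup = solve-∀

  distSq-difference : (α β₁ β₂ : Vec ℤ n) → ⟪ β₁ , β₁ ⟫ ≡ ⟪ β₂ , β₂ ⟫ →
    distSq (suc n) α β₁ - distSq (suc n) α β₂ ≡ deviation α β₂ - deviation α β₁
  distSq-difference {n} α β₁ β₂ same-norm = begin
    distSq (suc n) α β₁ - distSq (suc n) α β₂
      ≡⟨ cong₂ _-_ (distSq-expand α β₁) (distSq-expand α β₂) ⟩
    (C ⟪ β₁ , β₁ ⟫ - deviation α β₁) - (C ⟪ β₂ , β₂ ⟫ - deviation α β₂)
      ≡⟨ cong (λ b → (C b - deviation α β₁) - (C ⟪ β₂ , β₂ ⟫ - deviation α β₂)) same-norm ⟩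
    (C ⟪ β₂ , β₂ ⟫ - deviation α β₁) - (C ⟪ β₂ , β₂ ⟫ - deviation α β₂)
      ≡⟨ cancel (C ⟪ β₂ , β₂ ⟫) (deviation α β₁) (deviation α β₂) ⟩
    deviation α β₂ - deviation α β₁ ∎
    where
    open ≡-Reasoning
    C : ℤ → ℤ
    C b = + suc n * + suc n * (b + ⟪ α , α ⟫) - + suc (suc n) * (Σᵥ α * Σᵥ α)
    cancel : ∀ c x y → (c - x) - (c - y) ≡ y - x
    cancel = solve-∀

  ∣deviation∣≤ : (α β : Vec ℤ n) →
    ∣ deviation α β ∣ ℕ.≤
      2 ℕ.* (suc n ℕ.* suc n) ℕ.* ∣ ⟪ β , α ⟫ ∣ ℕ.+ suc (suc n) ℕ.* (∣ Σᵥ β ∣ ℕ.* (∣ Σᵥ β ∣ ℕ.+ 2 ℕ.* ∣ Σᵥ α ∣))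
  ∣deviation∣≤ {n} α β = ℕ.≤-trans (ℤ.∣i+j∣≤∣i∣+∣j∣ (+ 2 * (P * P) * ⟪ β , α ⟫) ((1ℤ + P) * (s * (s - + 2 * a))))
    (ℕ.+-mono-≤ (ℕ.≤-reflexive (ℤ.abs-* (+ 2 * (P * P)) ⟪ β , α ⟫)) sum-term)
    where
    P s a : ℤ
    P = + suc n
    s = Σᵥ β
    a = Σᵥ α
    sum-term : ∣ (1ℤ + P) * (s * (s - + 2 * a)) ∣ ℕ.≤ suc (suc n) ℕ.* (∣ s ∣ ℕ.* (∣ s ∣ ℕ.+ 2 ℕ.* ∣ a ∣))
    sum-term = begin
      ∣ (1ℤ + P) * (s * (s - + 2 * a)) ∣       ≡⟨ ℤ.abs-* (1ℤ + P) (s * (s - + 2 * a)) ⟩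
      suc (suc n) ℕ.* ∣ s * (s - + 2 * a) ∣     ≡⟨ cong (suc (suc n) ℕ.*_) (ℤ.abs-* s (s - + 2 * a)) ⟩
      suc (suc n) ℕ.* (∣ s ∣ ℕ.* ∣ s - + 2 * a ∣)
        ≤⟨ ℕ.*-monoʳ-≤ (suc (suc n)) (ℕ.*-monoʳ-≤ ∣ s ∣
             (ℕ.≤-trans (ℤ.∣i-j∣≤∣i∣+∣j∣ s (+ 2 * a)) (ℕ.≤-reflexive (cong (∣ s ∣ ℕ.+_) (ℤ.abs-* (+ 2) a))))) ⟩
      suc (suc n) ℕ.* (∣ s ∣ ℕ.* (∣ s ∣ ℕ.+ 2 ℕ.* ∣ a ∣)) ∎
      where open ℕ.≤-Reasoning

module Estimates where

  open import Data.Nat.Base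
  open import Data.Nat.Properties
  open import Data.Nat.Tactic.RingSolver using (solve-∀)
  open import Relation.Binary.PropositionalEquality

  deviation-estimate : ∀ {T n N u v w} → 1 ≤ T → T * u ≤ n * N * N → T * v ≤ n * N → w ≤ n * N →
    T * (2 * (suc n * suc n) * u + suc (suc n) * (v * (v + 2 * w))) ≤ 5 * (suc n * suc n * (n * N * N))
  deviation-estimate {T} {n} {N} {u} {v} {w} 1≤T Tu≤ Tv≤ w≤ = begin
    T * (2 * (P * P) * u + suc P * (v * (v + 2 * w)))
      ≡⟨ distribute T P u v w ⟩
    2 * (P * P) * (T * u) + suc P * (T * v) * (v + 2 * w)
      ≤⟨ +-mono-≤ (*-monoʳ-≤ (2 * (P * P)) Tu≤) (*-mono-≤ (*-monoʳ-≤ (suc P) Tv≤) (+-mono-≤ v≤ (*-monoʳ-≤ 2 w≤))) ⟩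
    2 * (P * P) * (n * N * N) + suc P * (n * N) * (n * N + 2 * (n * N))
      ≡⟨ collect P n N ⟩
    2 * (P * P) * (n * N * N) + 3 * (suc P * n) * (n * N * N)
      ≤⟨ +-monoʳ-≤ (2 * (P * P) * (n * N * N)) (*-monoˡ-≤ (n * N * N) (*-monoʳ-≤ 3 ([n+2]n≤[n+1]² n))) ⟩
    2 * (P * P) * (n * N * N) + 3 * (P * P) * (n * N * N)
      ≡⟨ add P n N ⟩
    5 * (P * P * (n * N * N)) ∎
    where
    open ≤-Reasoning
    P : ℕ
    P = suc n
    v≤ : v ≤ n * N
    v≤ = ≤-trans (m≤n*m v T {{>-nonZero 1≤T}}) Tv≤
    [n+2]n≤[n+1]² : ∀ n → suc (suc n) * n ≤ suc n * suc n
    [n+2]n≤[n+1]² n = ≤-trans (n≤1+n _) (≤-reflexive (square n))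
      where
      square : ∀ n → suc (suc (suc n) * n) ≡ suc n * suc n
      square = solve-∀
    distribute : ∀ T P u v w → T * (2 * (P * P) * u + suc P * (v * (v + 2 * w))) ≡ 2 * (P * P) * (T * u) + suc P * (T * v) * (v + 2 * w)
    distribute = solve-∀
    collect : ∀ P n N → 2 * (P * P) * (n * N * N) + suc P * (n * N) * (n * N + 2 * (n * N)) ≡ 2 * (P * P) * (n * N * N) + 3 * (suc P * n) * (n * N * N)
    collect = solve-∀
    add : ∀ P n N → 2 * (P * P) * (n * N * N) + 3 * (P * P) * (n * N * N) ≡ 5 * (P * P * (n * N * N))
    add = solve-∀

  large-fraction-squared : ∀ k {G c V} → V ≤ G + c → 2 * suc k * c ≤ V → k * (V * V) ≤ suc k * (G * G)
  large-fraction-squared k {G} {c} {V} V≤G+c 2Kc≤V = *-cancelˡ-≤ (4 * K) (begin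
    4 * K * (k * (V * V))              ≤⟨ m≤n+m _ (V * V) ⟩
    V * V + 4 * K * (k * (V * V))      ≡⟨ odd-square k V ⟩
    (2 * k + 1) * V * ((2 * k + 1) * V) ≤⟨ *-mono-≤ [2k+1]V≤2KG [2k+1]V≤2KG ⟩
    2 * K * G * (2 * K * G)            ≡⟨ even-square k G ⟩
    4 * K * (K * (G * G))              ∎)
    where
    open ≤-Reasoning
    K : ℕ
    K = suc k
    [2k+1]V≤2KG : (2 * k + 1) * V ≤ 2 * K * G
    [2k+1]V≤2KG = +-cancelʳ-≤ V _ _ (begin
      (2 * k + 1) * V + V   ≡⟨ split k V ⟩
      2 * K * V             ≤⟨ *-monoʳ-≤ (2 * K) V≤G+c ⟩
      2 * K * (G + c)       ≡⟨ *-distribˡ-+ (2 * K) G c ⟩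
      2 * K * G + 2 * K * c ≤⟨ +-monoʳ-≤ (2 * K * G) 2Kc≤V ⟩
      2 * K * G + V         ∎)
      where
      split : ∀ k V → (2 * k + 1) * V + V ≡ 2 * suc k * V
      split = solve-∀
    odd-square : ∀ k V → V * V + 4 * suc k * (k * (V * V)) ≡ (2 * k + 1) * V * ((2 * k + 1) * V)
    odd-square = solve-∀
    even-square : ∀ k G → 2 * suc k * G * (2 * suc k * G) ≡ 4 * suc k * (suc k * (G * G))
    even-square = solve-∀

module SignVectors where

  open Norm using (⟪_,_⟫)
  open import Data.Bool.Base using (Bool; true; false; if_then_else_)
  open import Data.Nat.Base as ℕ using (ℕ; zero; suc; _^_)
  import Data.Nat.Properties as ℕ
  open import Data.Integer.Base using (ℤ; +_; -_; -[1+_]; _+_; _*_; ∣_∣; 0ℤ; _≤_; +≤+)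
  import Data.Integer.Properties as ℤ
  open import Data.Integer.Tactic.RingSolver using (solve-∀)
  import Data.Nat.Tactic.RingSolver as ℕSolver
  open import Data.List.Base using (List; []; _∷_; _++_; map; foldr; length; filter)
  open import Data.List.Properties using (length-++; length-map; map-++; map-∘; map-cong)
  open import Data.Vec.Base using (Vec; []; _∷_)
  open import Function.Base using (_∘_)
  open import Level using (0ℓ)
  open import Relation.Nullary using (yes; no)
  open import Relation.Unary using (Pred; Decidable)
  open import Relation.Binary.PropositionalEquality

  private variable
    A : Set
    n : ℕ

  sumℤ : List ℤ → ℤ
  sumℤ = foldr _+_ 0ℤ

  sumℤ-++ : (xs ys : List ℤ) → sumℤ (xs ++ ys) ≡ sumℤ xs + sumℤ ys
  sumℤ-++ []       ys = sym (ℤ.+-identityˡ (sumℤ ys))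
  sumℤ-++ (x ∷ xs) ys = trans (cong (_+_ x) (sumℤ-++ xs ys)) (sym (ℤ.+-assoc x (sumℤ xs) (sumℤ ys)))

  sumℤ-map-+ : (f g : A → ℤ) (xs : List A) → sumℤ (map (λ x → f x + g x) xs) ≡ sumℤ (map f xs) + sumℤ (map g xs)
  sumℤ-map-+ f g []       = refl
  sumℤ-map-+ f g (x ∷ xs) = trans (cong (_+_ (f x + g x)) (sumℤ-map-+ f g xs)) (interchange (f x) (g x) _ _)
    where
    interchange : ∀ a b c d → a + b + (c + d) ≡ a + c + (b + d)
    interchange = solve-∀

  sumℤ-map-* : (c : ℤ) (f : A → ℤ) (xs : List A) → sumℤ (map (λ x → c * f x) xs) ≡ c * sumℤ (map f xs)
  sumℤ-map-* c f []       = sym (ℤ.*-zeroʳ c)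
  sumℤ-map-* c f (x ∷ xs) = trans (cong (_+_ (c * f x)) (sumℤ-map-* c f xs)) (sym (ℤ.*-distribˡ-+ c (f x) _))

  sumℤ-map-const : (c : ℤ) (xs : List A) → sumℤ (map (λ _ → c) xs) ≡ + length xs * c
  sumℤ-map-const c []       = refl
  sumℤ-map-const c (x ∷ xs) = trans (cong (_+_ c) (sumℤ-map-const c xs)) (sym (ℤ.suc-* (+ length xs) c))

  vertices : (n N : ℕ) → List (Vec ℤ n)
  vertices n N = map (vertex N) (allSigns n)

  length-allSigns : ∀ n → length (allSigns n) ≡ 2 ^ n
  length-allSigns zero    = refl
  length-allSigns (suc n) = begin
    length (map (true ∷_) S ++ map (false ∷_) S)            ≡⟨ length-++ (map (true ∷_) S) ⟩
    length (map (true ∷_) S) ℕ.+ length (map (false ∷_) S)  ≡⟨ cong₂ ℕ._+_ (length-map (true ∷_) S) (length-map (false ∷_) S) ⟩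
    length S ℕ.+ length S                                   ≡⟨ cong (λ m → m ℕ.+ m) (length-allSigns n) ⟩
    2 ^ n ℕ.+ 2 ^ n                                         ≡⟨ cong (2 ^ n ℕ.+_) (ℕ.+-identityʳ (2 ^ n)) ⟨
    2 ^ suc n                                               ∎
    where
    open ≡-Reasoning
    S : List (Vec Bool n)
    S = allSigns n

  length-vertices : ∀ n N → length (vertices n N) ≡ 2 ^ n
  length-vertices n N = trans (length-map (vertex N) (allSigns n)) (length-allSigns n)

  vertices-suc : ∀ n N → vertices (suc n) N ≡ map (+ N ∷_) (vertices n N) ++ map (- (+ N) ∷_) (vertices n N)
  vertices-suc n N = begin
    map (vertex N) (map (true ∷_) S ++ map (false ∷_) S)
      ≡⟨ map-++ (vertex N) (map (true ∷_) S) (map (false ∷_) S) ⟩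
    map (vertex N) (map (true ∷_) S) ++ map (vertex N) (map (false ∷_) S)
      ≡⟨ cong₂ _++_ (trans (sym (map-∘ S)) (map-∘ S)) (trans (sym (map-∘ S)) (map-∘ S)) ⟩
    map (+ N ∷_) (vertices n N) ++ map (- (+ N) ∷_) (vertices n N) ∎
    where
    open ≡-Reasoning
    S : List (Vec Bool n)
    S = allSigns n

  ⟪vertex,vertex⟫ : ∀ N (s : Vec Bool n) → ⟪ vertex N s , vertex N s ⟫ ≡ + (n ℕ.* (N ℕ.* N))
  ⟪vertex,vertex⟫         N []      = refl
  ⟪vertex,vertex⟫ {suc n} N (b ∷ s) = begin
    x b * x b + ⟪ vertex N s , vertex N s ⟫   ≡⟨ cong₂ _+_ (x² b) (⟪vertex,vertex⟫ N s) ⟩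
    + (N ℕ.* N) + + (n ℕ.* (N ℕ.* N))          ≡⟨ ℤ.pos-+ (N ℕ.* N) (n ℕ.* (N ℕ.* N)) ⟨
    + (suc n ℕ.* (N ℕ.* N))                    ∎
    where
    open ≡-Reasoning
    x : Bool → ℤ
    x b = if b then + N else - (+ N)
    x² : ∀ b → x b * x b ≡ + (N ℕ.* N)
    x² true  = sym (ℤ.pos-* N N)
    x² false = trans (neg² (+ N)) (sym (ℤ.pos-* N N))
      where
      neg² : ∀ y → - y * - y ≡ y * y
      neg² = solve-∀

  pos-2^n*N² : ∀ n N → + (2 ^ n ℕ.* (N ℕ.* N)) ≡ + (2 ^ n) * (+ N * + N)
  pos-2^n*N² n N = trans (ℤ.pos-* (2 ^ n) (N ℕ.* N)) (cong (_*_ (+ (2 ^ n))) (ℤ.pos-* N N))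

  second-moment : ∀ n N (y : Vec ℤ n) →
    sumℤ (map (λ β → ⟪ β , y ⟫ * ⟪ β , y ⟫) (vertices n N)) ≡ + (2 ^ n ℕ.* (N ℕ.* N)) * ⟪ y , y ⟫
  second-moment zero    N []      = sym (ℤ.*-zeroʳ (+ (N ℕ.* N ℕ.+ 0)))
  second-moment (suc n) N (y₀ ∷ y) = begin
    sumℤ (map F (vertices (suc n) N))
      ≡⟨ cong (sumℤ ∘ map F) (vertices-suc n N) ⟩
    sumℤ (map F (map (+ N ∷_) V ++ map (- (+ N) ∷_) V))
      ≡⟨ trans (cong sumℤ (map-++ F (map (+ N ∷_) V) _)) (sumℤ-++ (map F (map (+ N ∷_) V)) _) ⟩
    sumℤ (map F (map (+ N ∷_) V)) + sumℤ (map F (map (- (+ N) ∷_) V))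
      ≡⟨ cong₂ _+_ (cong sumℤ (map-∘ V)) (cong sumℤ (map-∘ V)) ⟨
    sumℤ (map (λ β → (+ N * y₀ + d β) * (+ N * y₀ + d β)) V) + sumℤ (map (λ β → (- (+ N) * y₀ + d β) * (- (+ N) * y₀ + d β)) V)
      ≡⟨ sumℤ-map-+ _ _ V ⟨
    sumℤ (map (λ β → (+ N * y₀ + d β) * (+ N * y₀ + d β) + (- (+ N) * y₀ + d β) * (- (+ N) * y₀ + d β)) V)
      ≡⟨ cong sumℤ (map-cong (λ β → parallelogram (+ N) y₀ (d β)) V) ⟩
    sumℤ (map (λ β → + 2 * (+ N * y₀ * (+ N * y₀)) + + 2 * (d β * d β)) V)
      ≡⟨ trans (sumℤ-map-+ _ _ V) (cong₂ _+_ (sumℤ-map-const _ V) (sumℤ-map-* (+ 2) (λ β → d β * d β) V)) ⟩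
    + length V * (+ 2 * (+ N * y₀ * (+ N * y₀))) + + 2 * sumℤ (map (λ β → d β * d β) V)
      ≡⟨ cong₂ (λ l s → + l * (+ 2 * (+ N * y₀ * (+ N * y₀))) + + 2 * s) (length-vertices n N) (second-moment n N y) ⟩
    + (2 ^ n) * (+ 2 * (+ N * y₀ * (+ N * y₀))) + + 2 * (+ (2 ^ n ℕ.* (N ℕ.* N)) * ⟪ y , y ⟫)
      ≡⟨ cong (λ w → + (2 ^ n) * (+ 2 * (+ N * y₀ * (+ N * y₀))) + + 2 * (w * ⟪ y , y ⟫)) (pos-2^n*N² n N) ⟩
    + (2 ^ n) * (+ 2 * (+ N * y₀ * (+ N * y₀))) + + 2 * (+ (2 ^ n) * (+ N * + N) * ⟪ y , y ⟫)
      ≡⟨ collect (+ (2 ^ n)) (+ N) y₀ ⟪ y , y ⟫ ⟩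
    + 2 * + (2 ^ n) * (+ N * + N) * (y₀ * y₀ + ⟪ y , y ⟫)
      ≡⟨ cong (_* (y₀ * y₀ + ⟪ y , y ⟫)) (trans (pos-2^n*N² (suc n) N) (cong (_* (+ N * + N)) (ℤ.pos-* 2 (2 ^ n)))) ⟨
    + (2 ^ suc n ℕ.* (N ℕ.* N)) * ⟪ y₀ ∷ y , y₀ ∷ y ⟫ ∎
    where
    open ≡-Reasoning
    V : List (Vec ℤ n)
    V = vertices n N
    F : Vec ℤ (suc n) → ℤ
    F β = ⟪ β , y₀ ∷ y ⟫ * ⟪ β , y₀ ∷ y ⟫
    d : Vec ℤ n → ℤ
    d β = ⟪ β , y ⟫
    parallelogram : ∀ N y d → (N * y + d) * (N * y + d) + (- N * y + d) * (- N * y + d) ≡ + 2 * (N * y * (N * y)) + + 2 * (d * d)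
    parallelogram = solve-∀
    collect : ∀ V N y₀ Q → V * (+ 2 * (N * y₀ * (N * y₀))) + + 2 * (V * (N * N) * Q) ≡ + 2 * V * (N * N) * (y₀ * y₀ + Q)
    collect = solve-∀

  markov : {P : Pred A 0ℓ} (P? : Decidable P) (h : A → ℤ) (a : ℕ) (xs : List A) →
    (∀ x → 0ℤ ≤ h x) → (∀ {x} → P x → + a ≤ h x) →
    + (length (filter P? xs) ℕ.* a) ≤ sumℤ (map h xs)
  markov P? h a []       _      _   = ℤ.≤-refl
  markov P? h a (x ∷ xs) h≥0 P⇒a≤h with P? x
  ... | yes px = ℤ.≤-trans (ℤ.≤-reflexive (ℤ.pos-+ a _)) (ℤ.+-mono-≤ (P⇒a≤h px) (markov P? h a xs h≥0 P⇒a≤h))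
  ... | no  _  = ℤ.≤-trans (markov P? h a xs h≥0 P⇒a≤h) (ℤ.≤-trans (ℤ.≤-reflexive (sym (ℤ.+-identityˡ _))) (ℤ.+-monoˡ-≤ _ (h≥0 x)))

  square-abs : ∀ w → w * w ≡ + (∣ w ∣ ℕ.* ∣ w ∣)
  square-abs (+ m)    = sym (ℤ.pos-* m m)
  square-abs -[1+ m ] = refl

  chebyshev : (z : A → ℤ) (T a : ℕ) (xs : List A) →
    + (length (filter (λ x → a ℕ.<? T ℕ.* ∣ z x ∣) xs) ℕ.* (a ℕ.* a)) ≤ + (T ℕ.* T) * sumℤ (map (λ x → z x * z x) xs)
  chebyshev {A = A} z T a xs = ℤ.≤-trans
    (markov (λ x → a ℕ.<? T ℕ.* ∣ z x ∣) h (a ℕ.* a) xs (λ x → subst (0ℤ ≤_) (sym (h≡ x)) (+≤+ ℕ.z≤n)) a²≤h)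
    (ℤ.≤-reflexive (sumℤ-map-* (+ (T ℕ.* T)) (λ x → z x * z x) xs))
    where
    h : A → ℤ
    h x = + (T ℕ.* T) * (z x * z x)
    h≡ : ∀ x → h x ≡ + (T ℕ.* T ℕ.* (∣ z x ∣ ℕ.* ∣ z x ∣))
    h≡ x = trans (cong (_*_ (+ (T ℕ.* T))) (square-abs (z x))) (sym (ℤ.pos-* (T ℕ.* T) _))
    a²≤h : ∀ {x} → a ℕ.< T ℕ.* ∣ z x ∣ → + (a ℕ.* a) ≤ h x
    a²≤h {x} a<T∣z∣ = subst (+ (a ℕ.* a) ≤_) (sym (h≡ x))
      (+≤+ (ℕ.≤-trans (ℕ.*-mono-≤ (ℕ.<⇒≤ a<T∣z∣) (ℕ.<⇒≤ a<T∣z∣)) (ℕ.≤-reflexive (interchange T ∣ z x ∣))))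
      where
      interchange : ∀ T w → T ℕ.* w ℕ.* (T ℕ.* w) ≡ T ℕ.* T ℕ.* (w ℕ.* w)
      interchange = ℕSolver.solve-∀

  Correlated : (T a : ℕ) → Vec ℤ n → Pred (Vec ℤ n) 0ℓ
  Correlated T a y β = a ℕ.< T ℕ.* ∣ ⟪ β , y ⟫ ∣

  correlated? : ∀ T a (y : Vec ℤ n) → Decidable (Correlated T a y)
  correlated? T a y β = a ℕ.<? T ℕ.* ∣ ⟪ β , y ⟫ ∣

  few-correlated : ∀ {n} N M T (y : Vec ℤ n) → ⟪ y , y ⟫ ≤ + (n ℕ.* (M ℕ.* M)) → 1 ℕ.≤ n → 1 ℕ.≤ N → 1 ℕ.≤ M →
    length (filter (correlated? T (n ℕ.* N ℕ.* M) y) (vertices n N)) ℕ.* n ℕ.≤ T ℕ.* T ℕ.* 2 ^ n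
  few-correlated {n} N M T y ⟪y,y⟫≤ 1≤n 1≤N 1≤M = ℕ.*-cancelʳ-≤ (c ℕ.* n) (T ℕ.* T ℕ.* 2 ^ n) Z {{Z≢0}} (ℤ.drop‿+≤+ (begin
    + (c ℕ.* n ℕ.* Z)                                                ≡⟨ cong +_ (regroup c n N M) ⟩
    + (c ℕ.* (a ℕ.* a))                                              ≤⟨ chebyshev (λ β → ⟪ β , y ⟫) T a (vertices n N) ⟩
    + (T ℕ.* T) * sumℤ (map (λ β → ⟪ β , y ⟫ * ⟪ β , y ⟫) (vertices n N)) ≡⟨ cong (_*_ (+ (T ℕ.* T))) (second-moment n N y) ⟩
    + (T ℕ.* T) * (+ (2 ^ n ℕ.* (N ℕ.* N)) * ⟪ y , y ⟫)
      ≤⟨ ℤ.*-monoˡ-≤-nonNeg (+ (T ℕ.* T)) (ℤ.*-monoˡ-≤-nonNeg (+ (2 ^ n ℕ.* (N ℕ.* N))) ⟪y,y⟫≤) ⟩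
    + (T ℕ.* T) * (+ (2 ^ n ℕ.* (N ℕ.* N)) * + (n ℕ.* (M ℕ.* M)))
      ≡⟨ trans (ℤ.pos-* (T ℕ.* T) _) (cong (_*_ (+ (T ℕ.* T))) (ℤ.pos-* (2 ^ n ℕ.* (N ℕ.* N)) (n ℕ.* (M ℕ.* M)))) ⟨
    + (T ℕ.* T ℕ.* (2 ^ n ℕ.* (N ℕ.* N) ℕ.* (n ℕ.* (M ℕ.* M))))      ≡⟨ cong +_ (regroup′ T (2 ^ n) N n M) ⟩
    + (T ℕ.* T ℕ.* 2 ^ n ℕ.* Z)                                      ∎))
    where
    open ℤ.≤-Reasoning
    a c Z : ℕ
    a = n ℕ.* N ℕ.* M
    c = length (filter (correlated? T a y) (vertices n N))
    Z = N ℕ.* N ℕ.* (n ℕ.* (M ℕ.* M))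
    Z≢0 : ℕ.NonZero Z
    Z≢0 = ℕ.>-nonZero (ℕ.*-mono-≤ (ℕ.*-mono-≤ 1≤N 1≤N) (ℕ.*-mono-≤ 1≤n (ℕ.*-mono-≤ 1≤M 1≤M)))
    regroup : ∀ c n N M → c ℕ.* n ℕ.* (N ℕ.* N ℕ.* (n ℕ.* (M ℕ.* M))) ≡ c ℕ.* (n ℕ.* N ℕ.* M ℕ.* (n ℕ.* N ℕ.* M))
    regroup = ℕSolver.solve-∀
    regroup′ : ∀ T V N n M → T ℕ.* T ℕ.* (V ℕ.* (N ℕ.* N) ℕ.* (n ℕ.* (M ℕ.* M))) ≡ T ℕ.* T ℕ.* V ℕ.* (N ℕ.* N ℕ.* (n ℕ.* (M ℕ.* M)))
    regroup′ = ℕSolver.solve-∀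

module Counting where

  open import Data.Nat.Base
  open import Data.Nat.Properties
  open import Data.List.Base using (List; []; _∷_; _++_; map; filter; length; concatMap)
  open import Data.List.Properties using (length-++; filter-++)
  open import Data.List.Membership.Propositional using (_∈_)
  open import Data.List.Relation.Unary.Any using (here; there)
  open import Data.Product using (_,_)
  open import Relation.Binary.PropositionalEquality
  open import Function.Base using (_∘_)
  open import Relation.Nullary using (yes; no; contradiction)
  open import Relation.Unary using (Pred; Decidable)
  open import Relation.Unary.Properties using (∁?; _∪?_)

  private variable
    A B : Set
    P Q R : Pred A _

  length-filter-∁ : (P? : Decidable P) (xs : List A) → length (filter P? xs) + length (filter (∁? P?) xs) ≡ length xs
  length-filter-∁ P? []       = refl
  length-filter-∁ P? (x ∷ xs) with P? x
  ... | yes _ = cong suc (length-filter-∁ P? xs)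
  ... | no  _ = trans (+-suc _ _) (cong suc (length-filter-∁ P? xs))

  length-filter-∪ : (P? : Decidable P) (Q? : Decidable Q) (xs : List A) →
    length (filter (P? ∪? Q?) xs) ≤ length (filter P? xs) + length (filter Q? xs)
  length-filter-∪ P? Q? []       = z≤n
  length-filter-∪ P? Q? (x ∷ xs) with P? x | Q? x
  ... | yes _ | yes _ = s≤s (≤-trans (length-filter-∪ P? Q? xs) (+-monoʳ-≤ _ (n≤1+n _)))
  ... | yes _ | no  _ = s≤s (length-filter-∪ P? Q? xs)
  ... | no  _ | yes _ = ≤-trans (s≤s (length-filter-∪ P? Q? xs)) (≤-reflexive (sym (+-suc _ _)))
  ... | no  _ | no  _ = length-filter-∪ P? Q? xs

  length-filter-++ : (P? : Decidable P) (xs ys : List A) →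
    length (filter P? (xs ++ ys)) ≡ length (filter P? xs) + length (filter P? ys)
  length-filter-++ P? xs ys = trans (cong length (filter-++ P? xs ys)) (length-++ (filter P? xs))

  length-filter-map-mono : (P? : Decidable P) (Q? : Decidable Q) (f : A → B) (xs : List A) →
    (∀ {x} → x ∈ xs → P x → Q (f x)) → length (filter P? xs) ≤ length (filter Q? (map f xs))
  length-filter-map-mono P? Q? f []       _   = z≤n
  length-filter-map-mono P? Q? f (x ∷ xs) P⇒Q with P? x | Q? (f x)
  ... | yes _  | yes _   = s≤s (length-filter-map-mono P? Q? f xs (P⇒Q ∘ there))
  ... | yes px | no ¬qfx = contradiction (P⇒Q (here refl) px) ¬qfx
  ... | no  _  | yes _   = m≤n⇒m≤1+n (length-filter-map-mono P? Q? f xs (P⇒Q ∘ there))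
  ... | no  _  | no  _   = length-filter-map-mono P? Q? f xs (P⇒Q ∘ there)

  length-filter-pairs : (P? : Decidable P) (R? : Decidable R) (xs : List A) →
    (∀ {x y} → x ∈ xs → y ∈ xs → P x → P y → R (x , y)) →
    length (filter P? xs) * length (filter P? xs) ≤ length (filter R? (pairs xs))
  length-filter-pairs {P = P} {R = R} P? R? xs close = rows xs (λ x∈ → x∈)
    where
    row : ∀ {x} → x ∈ xs → P x → length (filter P? xs) ≤ length (filter R? (map (x ,_) xs))
    row x∈ px = length-filter-map-mono P? R? (_ ,_) xs (λ y∈ py → close x∈ y∈ px py)
    rows : ∀ zs → (∀ {z} → z ∈ zs → z ∈ xs) →
      length (filter P? zs) * length (filter P? xs) ≤ length (filter R? (concatMap (λ x → map (x ,_) xs) zs))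
    rows []       _   = z≤n
    rows (z ∷ zs) zs⊆ with P? z
    ... | yes pz = begin
      length (filter P? xs) + length (filter P? zs) * length (filter P? xs)
        ≤⟨ +-mono-≤ (row (zs⊆ (here refl)) pz) (rows zs (zs⊆ ∘ there)) ⟩
      length (filter R? (map (z ,_) xs)) + length (filter R? (concatMap (λ x → map (x ,_) xs) zs))
        ≡⟨ length-filter-++ R? (map (z ,_) xs) _ ⟨
      length (filter R? (map (z ,_) xs ++ concatMap (λ x → map (x ,_) xs) zs)) ∎
      where open ≤-Reasoning
    ... | no  _  = begin
      length (filter P? zs) * length (filter P? xs)
        ≤⟨ rows zs (zs⊆ ∘ there) ⟩
      length (filter R? (concatMap (λ x → map (x ,_) xs) zs))
        ≤⟨ m≤n+m _ _ ⟩
      length (filter R? (map (z ,_) xs)) + length (filter R? (concatMap (λ x → map (x ,_) xs) zs))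
        ≡⟨ length-filter-++ R? (map (z ,_) xs) _ ⟨
      length (filter R? (map (z ,_) xs ++ concatMap (λ x → map (x ,_) xs) zs)) ∎
      where open ≤-Reasoning

module RationalBounds where

  open import Data.Bool.Base using (T; true; false)
  open import Data.Nat.Base as ℕ using (ℕ; zero; suc)
  open import Data.Nat.Coprimality using (1-coprimeTo; sym)
  open import Data.Integer.Base as ℤ using (ℤ; +_; -[1+_]; +[1+_])
  import Data.Integer.Properties as ℤ
  open import Data.Rational.Base using (ℚ; mkℚ; ↧_; _+_; _*_; _-_; -_; _≤_; 0ℚ; 1ℚ; _≤ᵇ_; *≤*; Positive; nonNegative)
  open import Data.Rational.Properties
    using (normalize-coprime; ≤⇒≤ᵇ; ≰⇒>; <⇒≤; +-mono-≤; +-monoˡ-≤; +-monoʳ-≤; +-inverseʳ; +-identityʳ; *-identityˡ;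
           *-monoˡ-≤-nonNeg; *-monoʳ-≤-nonNeg; toℚᵘ-cancel-≤; toℚᵘ-homo-*; *-identityʳ; ≤ᵇ⇒≤; neg-antimono-≤;
           module ≤-Reasoning; *-cancelˡ-≤-pos; nonNeg*nonNeg⇒nonNeg; nonNegative⁻¹; pos*pos⇒pos; ≤-trans)
  open import Data.Rational.Solver using (module +-*-Solver)
  open import Data.Unit.Base using (tt)
  import Data.Rational.Unnormalised.Base as ℚᵘ
  import Data.Rational.Unnormalised.Properties as ℚᵘ
  import Data.Nat.Properties as ℕ
  open import Relation.Binary.PropositionalEquality using (_≡_; refl; cong; cong₂; subst; subst₂; trans) renaming (sym to ≡-sym)

  open +-*-Solver using (solve; _:+_; _:*_; _:-_; con; _:=_)

  private variable p q : ℚ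

  ℤ→ℚ≡mkℚ : ∀ z → ℤ→ℚ z ≡ mkℚ z 0 (sym (1-coprimeTo ℤ.∣ z ∣))
  ℤ→ℚ≡mkℚ (+ n)    = normalize-coprime (sym (1-coprimeTo n))
  ℤ→ℚ≡mkℚ -[1+ n ] = cong -_ (normalize-coprime (sym (1-coprimeTo (suc n))))

  ℤ→ℚ-+ : ∀ x y → ℤ→ℚ (x ℤ.+ y) ≡ ℤ→ℚ x + ℤ→ℚ y
  ℤ→ℚ-+ x y rewrite ℤ→ℚ≡mkℚ x | ℤ→ℚ≡mkℚ y = cong ℤ→ℚ (cong₂ ℤ._+_ (≡-sym (ℤ.*-identityʳ x)) (≡-sym (ℤ.*-identityʳ y)))

  ℤ→ℚ-* : ∀ x y → ℤ→ℚ (x ℤ.* y) ≡ ℤ→ℚ x * ℤ→ℚ y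
  ℤ→ℚ-* x y rewrite ℤ→ℚ≡mkℚ x | ℤ→ℚ≡mkℚ y = refl

  ℤ→ℚ-neg : ∀ x → ℤ→ℚ (ℤ.- x) ≡ - ℤ→ℚ x
  ℤ→ℚ-neg x rewrite ℤ→ℚ≡mkℚ x | ℤ→ℚ≡mkℚ (ℤ.- x) = neg-mkℚ x
    where
    neg-mkℚ : ∀ x → mkℚ (ℤ.- x) 0 (sym (1-coprimeTo ℤ.∣ ℤ.- x ∣)) ≡ - mkℚ x 0 (sym (1-coprimeTo ℤ.∣ x ∣))
    neg-mkℚ (+ zero) = refl
    neg-mkℚ +[1+ n ] = refl
    neg-mkℚ -[1+ n ] = refl

  ℤ→ℚ-- : ∀ x y → ℤ→ℚ (x ℤ.- y) ≡ ℤ→ℚ x - ℤ→ℚ y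
  ℤ→ℚ-- x y = trans (ℤ→ℚ-+ x (ℤ.- y)) (cong (_+_ (ℤ→ℚ x)) (ℤ→ℚ-neg y))

  ℤ→ℚ-mono-≤ : ∀ {x y} → x ℤ.≤ y → ℤ→ℚ x ≤ ℤ→ℚ y
  ℤ→ℚ-mono-≤ {x} {y} x≤y rewrite ℤ→ℚ≡mkℚ x | ℤ→ℚ≡mkℚ y =
    *≤* (subst₂ ℤ._≤_ (≡-sym (ℤ.*-identityʳ x)) (≡-sym (ℤ.*-identityʳ y)) x≤y)

  ℤ→ℚ-pos : ∀ k → Positive (ℤ→ℚ (+ suc k))
  ℤ→ℚ-pos k = subst Positive (≡-sym (ℤ→ℚ≡mkℚ (+ suc k))) _

  i≤+∣i∣ : ∀ i → i ℤ.≤ + ℤ.∣ i ∣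
  i≤+∣i∣ (+ m)    = ℤ.≤-refl
  i≤+∣i∣ -[1+ m ] = ℤ.-≤+

  p≤q⇒0≤q-p : p ≤ q → 0ℚ ≤ q - p
  p≤q⇒0≤q-p {p} {q} p≤q = subst (_≤ q - p) (+-inverseʳ p) (+-monoˡ-≤ (- p) p≤q)

  *-nonNeg : 0ℚ ≤ p → 0ℚ ≤ q → 0ℚ ≤ p * q
  *-nonNeg {p} {q} 0≤p 0≤q = nonNegative⁻¹ (p * q) {{nonNeg*nonNeg⇒nonNeg p {{nonNegative 0≤p}} q {{nonNegative 0≤q}}}}

  p≤p+q : 0ℚ ≤ q → p ≤ p + q
  p≤p+q {q} {p} 0≤q = subst (_≤ p + q) (+-identityʳ p) (+-monoʳ-≤ p 0≤q)

  -- |a − b| ≤ c gives |√a − √b| ≤ √c: if s = a + b − c > 0 then 4ab − s² = uv + us + vs, where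
  -- u, v ≥ 0 are the slacks of the two hypotheses.
  absSqrtDiffLeSqrt-intro : ∀ a b c → a - b ≤ c → b - a ≤ c → T (absSqrtDiffLeSqrt a b c)
  absSqrtDiffLeSqrt-intro a b c a-b≤c b-a≤c with (a + b - c) ≤ᵇ 0ℚ in s≤ᵇ0
  ... | true  = tt
  ... | false = ≤⇒≤ᵇ (subst (s * s ≤_) (≡-sym (four-ab a b c)) (p≤p+q slack≥0))
    where
    s u v : ℚ
    s = a + b - c
    u = c - (a - b)
    v = c - (b - a)
    s≥0 : 0ℚ ≤ s
    s≥0 = <⇒≤ (≰⇒> (λ s≤0 → subst T s≤ᵇ0 (≤⇒≤ᵇ s≤0)))
    u≥0 : 0ℚ ≤ u
    u≥0 = p≤q⇒0≤q-p a-b≤c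
    v≥0 : 0ℚ ≤ v
    v≥0 = p≤q⇒0≤q-p b-a≤c
    slack≥0 : 0ℚ ≤ u * v + u * s + v * s
    slack≥0 = +-mono-≤ (+-mono-≤ (*-nonNeg u≥0 v≥0) (*-nonNeg u≥0 s≥0)) (*-nonNeg v≥0 s≥0)
    four-ab : ∀ a b c → ℤ→ℚ (+ 4) * a * b ≡ (a + b - c) * (a + b - c) +
      ((c - (a - b)) * (c - (b - a)) + (c - (a - b)) * (a + b - c) + (c - (b - a)) * (a + b - c))
    four-ab = solve 3 (λ a b c → con (ℤ→ℚ (+ 4)) :* a :* b := (a :+ b :- c) :* (a :+ b :- c) :+
      ((c :- (a :- b)) :* (c :- (b :- a)) :+ (c :- (a :- b)) :* (a :+ b :- c) :+ (c :- (b :- a)) :* (a :+ b :- c))) refl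

  ≤-rescale : ∀ {w X k e} .{{_ : Positive k}} → 0ℚ ≤ X → 1ℚ ≤ e * k → k * k * w ≤ X → w ≤ e * e * X
  ≤-rescale {w} {X} {k} {e} 0≤X 1≤ek k²w≤X = *-cancelˡ-≤-pos (k * k) {{pos*pos⇒pos k k}} (begin
    k * k * w            ≤⟨ k²w≤X ⟩
    X                    ≡⟨ *-identityˡ X ⟨
    1ℚ * X               ≤⟨ *-monoʳ-≤-nonNeg X {{nonNegative 0≤X}} 1≤[ek]² ⟩
    e * k * (e * k) * X  ≡⟨ regroup e k X ⟩
    k * k * (e * e * X)  ∎)
    where
    open ≤-Reasoning
    0≤ek : 0ℚ ≤ e * k
    0≤ek = ≤-trans (≤ᵇ⇒≤ tt) 1≤ek
    1≤[ek]² : 1ℚ ≤ e * k * (e * k)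
    1≤[ek]² = ≤-trans 1≤ek (subst (_≤ e * k * (e * k)) (*-identityʳ (e * k)) (*-monoˡ-≤-nonNeg (e * k) {{nonNegative 0≤ek}} 1≤ek))
    regroup : ∀ e k X → e * k * (e * k) * X ≡ k * k * (e * e * X)
    regroup = solve 3 (λ e k X → e :* k :* (e :* k) :* X := k :* k :* (e :* e :* X)) refl

  gap-≤-ε² : ∀ {ε} k x y X → 1ℚ ≤ ε * ℤ→ℚ (+ suc k) → suc k ℕ.* suc k ℕ.* ℤ.∣ x ℤ.- y ∣ ℕ.≤ X →
    ℤ→ℚ x - ℤ→ℚ y ≤ ε * ε * ℤ→ℚ (+ X)
  gap-≤-ε² {ε} k x y X 1≤εK K²∣x-y∣≤X =
    ≤-rescale {ℤ→ℚ x - ℤ→ℚ y} {ℤ→ℚ (+ X)} {K′} {ε} {{ℤ→ℚ-pos k}} (ℤ→ℚ-mono-≤ {+ 0} {+ X} (ℤ.+≤+ ℕ.z≤n)) 1≤εK (begin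
      K′ * K′ * (ℤ→ℚ x - ℤ→ℚ y)      ≡⟨ homomorphic ⟨
      ℤ→ℚ (+ K ℤ.* + K ℤ.* (x ℤ.- y)) ≤⟨ ℤ→ℚ-mono-≤ K²[x-y]≤X ⟩
      ℤ→ℚ (+ X)                      ∎)
    where
    open ≤-Reasoning
    K : ℕ
    K = suc k
    K′ : ℚ
    K′ = ℤ→ℚ (+ K)
    homomorphic : ℤ→ℚ (+ K ℤ.* + K ℤ.* (x ℤ.- y)) ≡ K′ * K′ * (ℤ→ℚ x - ℤ→ℚ y)
    homomorphic = trans (ℤ→ℚ-* (+ K ℤ.* + K) (x ℤ.- y)) (cong₂ _*_ (ℤ→ℚ-* (+ K) (+ K)) (ℤ→ℚ-- x y))
    K²[x-y]≤X : + K ℤ.* + K ℤ.* (x ℤ.- y) ℤ.≤ + X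
    K²[x-y]≤X = ℤ.≤-trans (ℤ.*-monoˡ-≤-nonNeg (+ K ℤ.* + K) (i≤+∣i∣ (x ℤ.- y)))
      (subst (ℤ._≤ + X) (trans (ℤ.pos-* (K ℕ.* K) ℤ.∣ x ℤ.- y ∣) (cong (ℤ._* + ℤ.∣ x ℤ.- y ∣) (ℤ.pos-* K K))) (ℤ.+≤+ K²∣x-y∣≤X))

  one-minus-≤ : ∀ {ε K V C} .{{_ : Positive K}} → 0ℚ ≤ V → 1ℚ ≤ ε * K → (K - 1ℚ) * V ≤ K * C → (1ℚ - ε) * V ≤ C
  one-minus-≤ {ε} {K} {V} {C} 0≤V 1≤εK K-1V≤KC = *-cancelˡ-≤-pos K (begin
    K * ((1ℚ - ε) * V)     ≡⟨ expand K ε V ⟩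
    K * V - ε * K * V      ≤⟨ +-monoʳ-≤ (K * V) (neg-antimono-≤ (*-monoʳ-≤-nonNeg V {{nonNegative 0≤V}} 1≤εK)) ⟩
    K * V - 1ℚ * V         ≡⟨ collect K V ⟩
    (K - 1ℚ) * V           ≤⟨ K-1V≤KC ⟩
    K * C                  ∎)
    where
    open ≤-Reasoning
    expand : ∀ K ε V → K * ((1ℚ - ε) * V) ≡ K * V - ε * K * V
    expand = solve 3 (λ K ε V → K :* ((con 1ℚ :- ε) :* V) := K :* V :- ε :* K :* V) refl
    collect : ∀ K V → K * V - 1ℚ * V ≡ (K - 1ℚ) * V
    collect = solve 2 (λ K V → K :* V :- con 1ℚ :* V := (K :- con 1ℚ) :* V) refl

  1≤ε*↧ε : ∀ ε → Positive ε → 1ℚ ≤ ε * ℤ→ℚ (↧ ε)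
  1≤ε*↧ε ε@(mkℚ +[1+ a ] d _) _ rewrite ℤ→ℚ≡mkℚ (+ suc d) =
    toℚᵘ-cancel-≤ (ℚᵘ.≤-respʳ-≃ (ℚᵘ.≃-sym (toℚᵘ-homo-* ε (mkℚ (+ suc d) 0 (sym (1-coprimeTo (suc d))))))
                                (ℚᵘ.*≤* (ℤ.+≤+ 1≤[a+1][d+1])))
    where
    1≤[a+1][d+1] : 1 ℕ.* (suc d ℕ.* 1) ℕ.≤ suc a ℕ.* suc d ℕ.* 1
    1≤[a+1][d+1] = ℕ.≤-trans (ℕ.≤-reflexive (ℕ.*-identityˡ (suc d ℕ.* 1))) (ℕ.*-monoˡ-≤ 1 (ℕ.m≤n*m (suc d) (suc a)))

module Typical where

  open Norm
  open Estimates
  open SignVectors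
  open Counting
  open RationalBounds
  open import Data.Bool.Base using (T)
  open import Data.Bool.Properties using (T?)
  open import Data.Nat.Base as ℕ using (ℕ; zero; suc; _^_)
  import Data.Nat.Properties as ℕ
  import Data.Nat.Tactic.RingSolver as ℕSolver
  open import Data.Integer.Base using (ℤ; +_; -_; -[1+_]; _+_; _-_; _*_; ∣_∣; 0ℤ; 1ℤ; _≤_; +≤+; -≤-)
  import Data.Integer.Properties as ℤ
  import Data.Rational.Base as ℚ
  open import Data.Rational.Base using (ℚ; 1ℚ)
  import Data.Rational.Properties as ℚ
  open import Data.Vec.Base using (Vec; []; _∷_; replicate)
  open import Data.List.Base using (List; filter; length)
  open import Data.List.Membership.Propositional using (_∈_)
  open import Data.List.Membership.Propositional.Properties using (∈-map⁻)
  open import Data.Product using (_,_; proj₁; proj₂)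
  open import Data.Sum using (inj₁; inj₂)
  open import Function.Base using (_∘_)
  open import Level using (0ℓ)
  open import Relation.Binary.PropositionalEquality
  open import Relation.Nullary using (¬_)
  open import Relation.Unary using (Pred; Decidable; _∪_)
  open import Relation.Unary.Properties using (_∪?_; ∁?)

  private variable n N : ℕ

  box⇒∣x∣≤N : ∀ {x} → - (+ N) ≤ x → x ≤ + N → ∣ x ∣ ℕ.≤ N
  box⇒∣x∣≤N         {x = + m}    _         (+≤+ m≤N) = m≤N
  box⇒∣x∣≤N {suc N} {x = -[1+ m ]} (-≤- m≤N) _        = ℕ.s≤s m≤N

  box⇒⟪α,α⟫≤ : (α : Vec ℤ n) → InBox N α → ⟪ α , α ⟫ ≤ + (n ℕ.* (N ℕ.* N))
  box⇒⟪α,α⟫≤             []      _                    = ℤ.≤-refl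
  box⇒⟪α,α⟫≤ {suc n} {N} (x ∷ α) ((-N≤x , x≤N) , box) = begin
    x * x + ⟪ α , α ⟫                  ≤⟨ ℤ.+-mono-≤ x²≤N² (box⇒⟪α,α⟫≤ α box) ⟩
    + (N ℕ.* N) + + (n ℕ.* (N ℕ.* N))   ≡⟨ ℤ.pos-+ (N ℕ.* N) (n ℕ.* (N ℕ.* N)) ⟨
    + (suc n ℕ.* (N ℕ.* N))             ∎
    where
    open ℤ.≤-Reasoning
    ∣x∣≤N : ∣ x ∣ ℕ.≤ N
    ∣x∣≤N = box⇒∣x∣≤N -N≤x x≤N
    x²≤N² : x * x ≤ + (N ℕ.* N)
    x²≤N² = subst (_≤ + (N ℕ.* N)) (sym (square-abs x)) (+≤+ (ℕ.*-mono-≤ ∣x∣≤N ∣x∣≤N))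

  box⇒∣Σᵥα∣≤ : (α : Vec ℤ n) → InBox N α → ∣ Σᵥ α ∣ ℕ.≤ n ℕ.* N
  box⇒∣Σᵥα∣≤ []      _                    = ℕ.z≤n
  box⇒∣Σᵥα∣≤ (x ∷ α) ((-N≤x , x≤N) , box) =
    ℕ.≤-trans (ℤ.∣i+j∣≤∣i∣+∣j∣ x (Σᵥ α)) (ℕ.+-mono-≤ (box⇒∣x∣≤N -N≤x x≤N) (box⇒∣Σᵥα∣≤ α box))

  Σᵥ≡⟪,1⟫ : (u : Vec ℤ n) → Σᵥ u ≡ ⟪ u , replicate n 1ℤ ⟫
  Σᵥ≡⟪,1⟫ []      = refl
  Σᵥ≡⟪,1⟫ (x ∷ u) = cong₂ _+_ (sym (ℤ.*-identityʳ x)) (Σᵥ≡⟪,1⟫ u)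

  ⟪1,1⟫ : ∀ n → ⟪ replicate n 1ℤ , replicate n 1ℤ ⟫ ≡ + (n ℕ.* (1 ℕ.* 1))
  ⟪1,1⟫ zero    = refl
  ⟪1,1⟫ (suc n) = cong (_+_ 1ℤ) (⟪1,1⟫ n)

  vertices⇒⟪β,β⟫≡ : ∀ {β} → β ∈ vertices n N → ⟪ β , β ⟫ ≡ + (n ℕ.* (N ℕ.* N))
  vertices⇒⟪β,β⟫≡ {N = N} β∈ with ∈-map⁻ (vertex N) β∈
  ... | s , _ , refl = ⟪vertex,vertex⟫ N s

  Atypical : (T N : ℕ) → Vec ℤ n → Pred (Vec ℤ n) 0ℓ
  Atypical {n} T N α = Correlated T (n ℕ.* N ℕ.* N) α ∪ Correlated T (n ℕ.* N ℕ.* 1) (replicate n 1ℤ)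

  atypical? : ∀ T N (α : Vec ℤ n) → Decidable (Atypical T N α)
  atypical? {n} T N α = correlated? T (n ℕ.* N ℕ.* N) α ∪? correlated? T (n ℕ.* N ℕ.* 1) (replicate n 1ℤ)

  few-atypical : ∀ T (α : Vec ℤ n) → 1 ℕ.≤ n → 1 ℕ.≤ N → InBox N α →
    length (filter (atypical? T N α) (vertices n N)) ℕ.* n ℕ.≤ 2 ℕ.* (T ℕ.* T ℕ.* 2 ^ n)
  few-atypical {n} {N} T α 1≤n 1≤N box = begin
    length (filter (atypical? T N α) V) ℕ.* n
      ≤⟨ ℕ.*-monoˡ-≤ n (length-filter-∪ (correlated? T _ α) (correlated? T _ 𝟏) V) ⟩
    (length (filter (correlated? T _ α) V) ℕ.+ length (filter (correlated? T _ 𝟏) V)) ℕ.* n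
      ≡⟨ ℕ.*-distribʳ-+ n (length (filter (correlated? T _ α) V)) _ ⟩
    length (filter (correlated? T _ α) V) ℕ.* n ℕ.+ length (filter (correlated? T _ 𝟏) V) ℕ.* n
      ≤⟨ ℕ.+-mono-≤ (few-correlated N N T α (box⇒⟪α,α⟫≤ α box) 1≤n 1≤N 1≤N)
                    (few-correlated N 1 T 𝟏 (ℤ.≤-reflexive (⟪1,1⟫ n)) 1≤n 1≤N ℕ.≤-refl) ⟩
    T ℕ.* T ℕ.* 2 ^ n ℕ.+ T ℕ.* T ℕ.* 2 ^ n
      ≡⟨ cong (T ℕ.* T ℕ.* 2 ^ n ℕ.+_) (ℕ.+-identityʳ _) ⟨
    2 ℕ.* (T ℕ.* T ℕ.* 2 ^ n) ∎
    where
    open ℕ.≤-Reasoning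
    V : List (Vec ℤ n)
    V = vertices n N
    𝟏 : Vec ℤ n
    𝟏 = replicate n 1ℤ

  atypical-fraction : ∀ K τ (α : Vec ℤ n) → 1 ℕ.≤ K → 1 ℕ.≤ τ → 4 ℕ.* K ℕ.* (τ ℕ.* τ) ℕ.≤ n → 1 ℕ.≤ N → InBox N α →
    2 ℕ.* K ℕ.* length (filter (atypical? τ N α) (vertices n N)) ℕ.≤ length (vertices n N)
  atypical-fraction {n} {N} K τ α 1≤K 1≤τ 4Kτ²≤n 1≤N box = ℕ.*-cancelʳ-≤ _ _ (2 ℕ.* (τ ℕ.* τ)) {{2τ²≢0}} (begin
    2 ℕ.* K ℕ.* atypical ℕ.* (2 ℕ.* (τ ℕ.* τ))   ≡⟨ regroup K atypical τ ⟩
    atypical ℕ.* (4 ℕ.* K ℕ.* (τ ℕ.* τ))        ≤⟨ ℕ.*-monoʳ-≤ atypical 4Kτ²≤n ⟩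
    atypical ℕ.* n                              ≤⟨ few-atypical τ α 1≤n 1≤N box ⟩
    2 ℕ.* (τ ℕ.* τ ℕ.* 2 ^ n)                   ≡⟨ regroup′ τ (2 ^ n) ⟩
    2 ^ n ℕ.* (2 ℕ.* (τ ℕ.* τ))                 ≡⟨ cong (ℕ._* (2 ℕ.* (τ ℕ.* τ))) (length-vertices n N) ⟨
    length (vertices n N) ℕ.* (2 ℕ.* (τ ℕ.* τ)) ∎)
    where
    open ℕ.≤-Reasoning
    atypical : ℕ
    atypical = length (filter (atypical? τ N α) (vertices n N))
    1≤τ² : 1 ℕ.≤ τ ℕ.* τ
    1≤τ² = ℕ.*-mono-≤ 1≤τ 1≤τ
    2τ²≢0 : ℕ.NonZero (2 ℕ.* (τ ℕ.* τ))
    2τ²≢0 = ℕ.>-nonZero (ℕ.*-mono-≤ (ℕ.s≤s (ℕ.z≤n {1})) 1≤τ²)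
    1≤n : 1 ℕ.≤ n
    1≤n = ℕ.≤-trans (ℕ.*-mono-≤ (ℕ.*-mono-≤ (ℕ.s≤s (ℕ.z≤n {3})) 1≤K) 1≤τ²) 4Kτ²≤n
    regroup : ∀ K a τ → 2 ℕ.* K ℕ.* a ℕ.* (2 ℕ.* (τ ℕ.* τ)) ≡ a ℕ.* (4 ℕ.* K ℕ.* (τ ℕ.* τ))
    regroup = ℕSolver.solve-∀
    regroup′ : ∀ τ V → 2 ℕ.* (τ ℕ.* τ ℕ.* V) ≡ V ℕ.* (2 ℕ.* (τ ℕ.* τ))
    regroup′ = ℕSolver.solve-∀

  typical-deviation : ∀ {T} (α β : Vec ℤ n) → 1 ℕ.≤ T → InBox N α → ¬ Atypical T N α β →
    T ℕ.* ∣ deviation α β ∣ ℕ.≤ 5 ℕ.* (suc n ℕ.* suc n ℕ.* (n ℕ.* N ℕ.* N))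
  typical-deviation {n} {N} {T} α β 1≤T box typical = ℕ.≤-trans (ℕ.*-monoʳ-≤ T (∣deviation∣≤ α β))
    (deviation-estimate {T} {n} {N} 1≤T (ℕ.≮⇒≥ (typical ∘ inj₁)) T∣Σᵥβ∣≤ (box⇒∣Σᵥα∣≤ α box))
    where
    T∣Σᵥβ∣≤ : T ℕ.* ∣ Σᵥ β ∣ ℕ.≤ n ℕ.* N
    T∣Σᵥβ∣≤ = subst₂ (λ s b → T ℕ.* ∣ s ∣ ℕ.≤ b) (sym (Σᵥ≡⟪,1⟫ β)) (ℕ.*-identityʳ (n ℕ.* N)) (ℕ.≮⇒≥ (typical ∘ inj₂))

  threshold : ℕ → ℕ
  threshold k = 5 ℕ.* suc k ℕ.* suc k

  typical-gap : ∀ k (α β₁ β₂ : Vec ℤ n) → InBox N α → β₁ ∈ vertices n N → β₂ ∈ vertices n N →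
    ¬ Atypical (threshold k) N α β₁ → ¬ Atypical (threshold k) N α β₂ →
    suc k ℕ.* suc k ℕ.* ∣ distSq (suc n) α β₁ - distSq (suc n) α β₂ ∣ ℕ.≤ 4 ℕ.* N ℕ.* N ℕ.* suc n ℕ.* suc n ℕ.* n
  typical-gap {n} {N} k α β₁ β₂ box β₁∈ β₂∈ typ₁ typ₂ = begin
    K² ℕ.* ∣ distSq (suc n) α β₁ - distSq (suc n) α β₂ ∣
      ≡⟨ cong (λ d → K² ℕ.* ∣ d ∣) (distSq-difference α β₁ β₂ same-norm) ⟩
    K² ℕ.* ∣ deviation α β₂ - deviation α β₁ ∣
      ≤⟨ ℕ.*-monoʳ-≤ K² (ℤ.∣i-j∣≤∣i∣+∣j∣ (deviation α β₂) (deviation α β₁)) ⟩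
    K² ℕ.* (∣ deviation α β₂ ∣ ℕ.+ ∣ deviation α β₁ ∣)
      ≡⟨ ℕ.*-distribˡ-+ K² ∣ deviation α β₂ ∣ ∣ deviation α β₁ ∣ ⟩
    K² ℕ.* ∣ deviation α β₂ ∣ ℕ.+ K² ℕ.* ∣ deviation α β₁ ∣
      ≤⟨ ℕ.+-mono-≤ (K²∣deviation∣≤Y β₂ typ₂) (K²∣deviation∣≤Y β₁ typ₁) ⟩
    Y ℕ.+ Y
      ≤⟨ ℕ.m≤m+n (Y ℕ.+ Y) (Y ℕ.+ Y) ⟩
    Y ℕ.+ Y ℕ.+ (Y ℕ.+ Y)
      ≡⟨ four-Y n N ⟩
    4 ℕ.* N ℕ.* N ℕ.* suc n ℕ.* suc n ℕ.* n ∎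
    where
    open ℕ.≤-Reasoning
    same-norm : ⟪ β₁ , β₁ ⟫ ≡ ⟪ β₂ , β₂ ⟫
    same-norm = trans (vertices⇒⟪β,β⟫≡ β₁∈) (sym (vertices⇒⟪β,β⟫≡ β₂∈))
    K² : ℕ
    K² = suc k ℕ.* suc k
    Y : ℕ
    Y = suc n ℕ.* suc n ℕ.* (n ℕ.* N ℕ.* N)
    K²∣deviation∣≤Y : ∀ β → ¬ Atypical (threshold k) N α β → K² ℕ.* ∣ deviation α β ∣ ℕ.≤ Y
    K²∣deviation∣≤Y β typ =
      ℕ.*-cancelˡ-≤ 5 (ℕ.≤-trans (ℕ.≤-reflexive (assoc (suc k) ∣ deviation α β ∣))
                                  (typical-deviation {T = threshold k} α β (ℕ.s≤s ℕ.z≤n) box typ))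
      where
      assoc : ∀ K d → 5 ℕ.* (K ℕ.* K ℕ.* d) ≡ 5 ℕ.* K ℕ.* K ℕ.* d
      assoc = ℕSolver.solve-∀
    four-Y : ∀ n N → let Y = suc n ℕ.* suc n ℕ.* (n ℕ.* N ℕ.* N) in Y ℕ.+ Y ℕ.+ (Y ℕ.+ Y) ≡ 4 ℕ.* N ℕ.* N ℕ.* suc n ℕ.* suc n ℕ.* n
    four-Y = ℕSolver.solve-∀

  typical-close : ∀ {ε} k (α β₁ β₂ : Vec ℤ n) → 1ℚ ℚ.≤ ε ℚ.* ℤ→ℚ (+ suc k) → InBox N α →
    β₁ ∈ vertices n N → β₂ ∈ vertices n N → ¬ Atypical (threshold k) N α β₁ → ¬ Atypical (threshold k) N α β₂ →
    T (closeNormDist (suc n) N ε α β₁ β₂)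
  typical-close {n} {N} {ε} k α β₁ β₂ 1≤εK box β₁∈ β₂∈ typ₁ typ₂ = absSqrtDiffLeSqrt-intro (ℤ→ℚ D₁) (ℤ→ℚ D₂) _
    (gap-≤-ε² {ε} k D₁ D₂ X 1≤εK (typical-gap k α β₁ β₂ box β₁∈ β₂∈ typ₁ typ₂))
    (gap-≤-ε² {ε} k D₂ D₁ X 1≤εK (typical-gap k α β₂ β₁ box β₂∈ β₁∈ typ₂ typ₁))
    where
    D₁ D₂ : ℤ
    D₁ = distSq (suc n) α β₁
    D₂ = distSq (suc n) α β₂
    X : ℕ
    X = 4 ℕ.* N ℕ.* N ℕ.* suc n ℕ.* suc n ℕ.* n

  most-pairs-close : ∀ {ε} k (α : Vec ℤ n) → 1ℚ ℚ.≤ ε ℚ.* ℤ→ℚ (+ suc k) →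
    4 ℕ.* suc k ℕ.* (threshold k ℕ.* threshold k) ℕ.≤ n → 1 ℕ.≤ N → InBox N α →
    (1ℚ ℚ.- ε) ℚ.* ℤ→ℚ (+ (length (𝓥 (suc n) N) ℕ.* length (𝓥 (suc n) N))) ℚ.≤ ℤ→ℚ (+ closeCount (suc n) N ε α)
  most-pairs-close {n} {N} {ε} k α 1≤εK 4Kτ²≤n 1≤N box =
    one-minus-≤ {ε} {K′} {ℤ→ℚ (+ (L ℕ.* L))} {ℤ→ℚ (+ C)} {{ℤ→ℚ-pos k}}
      (ℤ→ℚ-mono-≤ {0ℤ} {+ (L ℕ.* L)} (+≤+ ℕ.z≤n)) 1≤εK (begin
      (K′ ℚ.- 1ℚ) ℚ.* ℤ→ℚ (+ (L ℕ.* L))    ≡⟨ cong (ℚ._* ℤ→ℚ (+ (L ℕ.* L))) (ℤ→ℚ-- (+ suc k) 1ℤ) ⟨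
      ℤ→ℚ (+ k) ℚ.* ℤ→ℚ (+ (L ℕ.* L))      ≡⟨ ℤ→ℚ-* (+ k) (+ (L ℕ.* L)) ⟨
      ℤ→ℚ (+ k * + (L ℕ.* L))              ≡⟨ cong ℤ→ℚ (ℤ.pos-* k (L ℕ.* L)) ⟨
      ℤ→ℚ (+ (k ℕ.* (L ℕ.* L)))            ≤⟨ ℤ→ℚ-mono-≤ (+≤+ (ℕ.≤-trans counting (ℕ.*-monoʳ-≤ (suc k) pairs-close))) ⟩
      ℤ→ℚ (+ (suc k ℕ.* C))                ≡⟨ trans (cong ℤ→ℚ (ℤ.pos-* (suc k) C)) (ℤ→ℚ-* (+ suc k) (+ C)) ⟩
      K′ ℚ.* ℤ→ℚ (+ C)                     ∎)
    where
    open ℚ.≤-Reasoning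
    K′ : ℚ
    K′ = ℤ→ℚ (+ suc k)
    outlier? : Decidable (Atypical (threshold k) N α)
    outlier? = atypical? (threshold k) N α
    V : List (Vec ℤ n)
    V = vertices n N
    L C atypical typical : ℕ
    L = length V
    C = closeCount (suc n) N ε α
    atypical = length (filter outlier? V)
    typical = length (filter (∁? outlier?) V)
    counting : k ℕ.* (L ℕ.* L) ℕ.≤ suc k ℕ.* (typical ℕ.* typical)
    counting = large-fraction-squared k {typical} {atypical} {L}
      (ℕ.≤-reflexive (trans (sym (length-filter-∁ outlier? V)) (ℕ.+-comm atypical typical)))
      (atypical-fraction (suc k) (threshold k) α (ℕ.s≤s ℕ.z≤n) (ℕ.s≤s ℕ.z≤n) 4Kτ²≤n 1≤N box)
    pairs-close : typical ℕ.* typical ℕ.≤ C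
    pairs-close = length-filter-pairs (∁? outlier?) (λ q → T? (closeNormDist (suc n) N ε α (proj₁ q) (proj₂ q))) V
      (λ β₁∈ β₂∈ typ₁ typ₂ → typical-close {ε = ε} k α _ _ 1≤εK box β₁∈ β₂∈ typ₁ typ₂)

open import Data.Nat using (ℕ; _≤_; _∸_; _*_)
open import Data.Nat.Primality using (Prime)
open import Data.Integer using (ℤ; +_)
open import Data.Rational using (ℚ; Positive; 1ℚ; _-_)
open import Data.Vec using (Vec)
open import Data.List using (length)
open import Data.Product using (Σ; _×_)
open import Relation.Binary.PropositionalEquality using (_≢_)

open import Data.Nat using (zero; suc; _<_)
open import Data.Nat.Properties using (<-≤-trans; ≤-pred; n≮0)
open import Data.Product using (_,_; proj₁; proj₂)
open import Relation.Nullary using (contradiction)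
open Euclid using (prime-above)
open RationalBounds using (1≤ε*↧ε)
open Typical using (threshold; most-pairs-close)

theorem1 : (ε : ℚ) → Positive ε →
    Σ ℕ (λ pε → Prime pε ×
      ((p : ℕ) → Prime p → p ≢ 2 → pε ≤ p →
       (N : ℕ) → 1 ≤ N →
       (α : Vec ℤ (p ∸ 1)) → InBox N α →
       Data.Rational._≤_
         ((1ℚ - ε) Data.Rational.* ℤ→ℚ (+ (length (𝓥 p N) * length (𝓥 p N))))
         (ℤ→ℚ (+ closeCount p N ε α))))
theorem1 ε ε>0 = pε , pε-prime , λ where
    zero    _ _ pε≤0             → contradiction (<-≤-trans B<pε pε≤0) n≮0
    (suc n) _ _ pε≤p N 1≤N α box →
      most-pairs-close {n} {N} {ε} k α (1≤ε*↧ε ε ε>0) (≤-pred (<-≤-trans B<pε pε≤p)) 1≤N box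
  where
  -- The denominator k + 1 of ε
  -- gives ε ≥ 1/(k+1), and p > B keeps the atypical vertices below a 1/(2(k+1)) fraction.
  k : ℕ
  k = Data.Rational.ℚ.denominator-1 ε
  B : ℕ
  B = 4 * suc k * (threshold k * threshold k)
  pε : ℕ
  pε = proj₁ (prime-above B)
  pε-prime : Prime pε
  pε-prime = proj₁ (proj₂ (prime-above B))
  B<pε : B < pε
  B<pε = proj₂ (proj₂ (prime-above B))
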